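{- Let $n\ge0$, let $a+bi\in\mathbb{Z}[i]$ with $(1+i)\nmid(a+bi)$, and let $x,y\in\mathbb{Z}$ with $2^k\parallel\gcd(x,y)$ for some $k\ge1$. If at least one of $(a-x)+(b-y)i$, $(a-y)+(b+x)i$, $-(b+x)+(a-y)i$ lies in $Oct_n$, then $x+yi\in U=\bigcup_{q\in\mathbb{Z}[i]}(B_n+q(a+bi))$.
   Context: For $k\ge0$, $w_{2k}=3\cdot2^k$, $w_{2k+1}=4\cdot2^k$. $Oct_n=\{x+yi\in\mathbb{Z}[i]: |x|,|y|\le w_n-2,\ |x|+|y|\le w_{n+1}-3\}$. $B_n=\{\sum_{j=0}^n v_j(1+i)^j: v_j\in\{0,\pm1,\pm i\}\}$. $2^k\parallel m$ means $2^k\mid m$ and $2^{k+1}\nmid m$. -}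

module Defs where

open import Data.Nat as ℕ using (ℕ; zero; suc)
open import Data.Integer as ℤ using (ℤ; +_; _+_; _-_; _*_; -_; ∣_∣; _≤_)
open import Data.Integer.GCD using (gcd)
open import Data.Integer.Divisibility using (_∣_)
open import Data.Fin using (Fin; zero; suc)
open import Data.Product using (Σ; ∃; _×_; _,_)
open import Relation.Nullary using (¬_)
open import Relation.Binary.PropositionalEquality using (_≡_)

record ℤ[i] : Set where
  constructor _+_i
  field
    re : ℤ
    im : ℤ
open ℤ[i] public

infixl 6 _⊕_
infixl 7 _⊗_
_⊕_ : ℤ[i] → ℤ[i] → ℤ[i]
(a + b i) ⊕ (c + d i) = (a + c) + (b + d) i

_⊗_ : ℤ[i] → ℤ[i] → ℤ[i]
(a + b i) ⊗ (c + d i) = (a * c - b * d) + (a * d + b * c) i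

0ᵍ 1ᵍ 1+i : ℤ[i]
0ᵍ = (+ 0) + (+ 0) i
1ᵍ = (+ 1) + (+ 0) i
1+i = (+ 1) + (+ 1) i

_^ᵍ_ : ℤ[i] → ℕ → ℤ[i]
z ^ᵍ zero = 1ᵍ
z ^ᵍ suc j = z ⊗ (z ^ᵍ j)

_∣ᵍ_ : ℤ[i] → ℤ[i] → Set
d ∣ᵍ z = ∃ λ q → z ≡ d ⊗ q

-- w_{2k} = 3·2^k, w_{2k+1} = 4·2^k
w : ℕ → ℕ
w zero = 3
w (suc zero) = 4
w (suc (suc n)) = 2 ℕ.* w n

Oct : ℕ → ℤ[i] → Set
Oct n (x + y i) =
  (+ ∣ x ∣ ≤ + w n - + 2) × (+ ∣ y ∣ ≤ + w n - + 2) × (+ ∣ x ∣ + + ∣ y ∣ ≤ + w (suc n) - + 3)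

data Digit : Set where
  d0 d1 d-1 di d-i : Digit

digit : Digit → ℤ[i]
digit d0 = (+ 0) + (+ 0) i
digit d1 = (+ 1) + (+ 0) i
digit d-1 = (- + 1) + (+ 0) i
digit di = (+ 0) + (+ 1) i
digit d-i = (+ 0) + (- + 1) i

expand : (m : ℕ) → (Fin m → Digit) → ℤ[i]
expand zero v = 0ᵍ
expand (suc m) v = digit (v zero) ⊕ (1+i ⊗ expand m (λ j → v (suc j)))

B : ℕ → ℤ[i] → Set
B n z = Σ (Fin (suc n) → Digit) λ v → z ≡ expand (suc n) v

U : ℕ → ℤ[i] → ℤ[i] → Set
U n α z = ∃ λ q → ∃ λ β → B n β × (z ≡ β ⊕ q ⊗ α)

pow2exactly : ℕ → ℤ → Set
pow2exactly k m = ((+ 2) ℤ.^ k ∣ m) × ¬ ((+ 2) ℤ.^ suc k ∣ m)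

-- Every point of Oct_n whose trace x + y is odd (i.e. which is not divisible by 1 + i) lies in B_n:
-- writing it as d + (1 + i) z' with a digit d, the octagon is shrunk from level n + 1 to level n
-- and z' again has odd trace, so induction on n applies.  Both sets are invariant under
-- multiplication by i, which reduces the peeling step to points 2p + (2q + 1)i with p ≥ 0, where
-- d = 1 works.  For the theorem, x and y are even while a + b is odd, so each of the given
-- octagon points γ has odd trace, and x + yi = -γ + q(a + bi) with q = 1 or q = i.
module Submission where

open import Defs
open import Data.Nat using (ℕ; _≥_; zero; suc; s≤s)
open import Data.Integer using (ℤ; _+_; _-_; -_)
open import Data.Integer.GCD using (gcd)
open import Data.Product using (∃; _×_)
open import Data.Sum using (_⊎_)
open import Relation.Nullary using (¬_)

import Data.Nat as ℕ
import Data.Nat.Properties as ℕ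
open import Data.Nat.Properties using (module ≤-Reasoning)
open import Data.Integer using (+_; -[1+_]; _*_; _^_; _≤_; ∣_∣; _%ℕ_; _/ℕ_; +≤+; -≤+)
open import Data.Integer.Properties
  using (≤-trans; ≤-total; +-mono-≤; +-monoˡ-≤; *-monoˡ-≤-nonNeg; *-cancelˡ-≤-pos;
         *-cancelˡ-<-nonNeg; suc[i]≤j⇒i<j; i<j⇒suc[i]≤j; neg-involutive; neg-mono-≤; neg-≤-pos;
         +-identityˡ; +-comm; abs-*; *-comm; pos-+; pos-*; ∣i+j∣≤∣i∣+∣j∣; ∣i-j∣≤∣i∣+∣j∣)
open import Data.Integer.DivMod using (n%ℕd<d; a≡a%ℕn+[a/ℕn]*n)
open import Data.Integer.Divisibility using () renaming (_∣_ to _∣ᵤ_)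
open import Data.Integer.Divisibility.Signed using (_∣_; divides; ∣ᵤ⇒∣; ∣-refl; ∣-trans; ∣m⇒∣m*n)
open import Data.Integer.GCD using (gcd[i,j]∣i; gcd[i,j]∣j)
open import Data.Integer.Tactic.RingSolver using (solve; solve-∀)
import Data.Nat.Divisibility as ℕ
open import Data.List using ([]; _∷_)
open import Data.Vec.Functional using () renaming (_∷_ to _◂_)
open import Data.Fin using (zero; suc)
open import Data.Product using (_,_; proj₁; proj₂)
open import Data.Sum using (inj₁; inj₂)
open import Data.Empty using (⊥; ⊥-elim)
open import Function using (_∘_)
open import Relation.Binary.PropositionalEquality
  using (_≡_; _≢_; refl; sym; trans; cong; cong₂; subst; subst₂; module ≡-Reasoning)

-- A linear inequality L ≤ R is certified by a sum S₁ ≤ S₂ of known ones together with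
-- ring identities S₁ = L + X and S₂ = R + X (resp. 2L + X and 2R + X).
≤-by-shift : ∀ {L R S₁ S₂} X → S₁ ≤ S₂ → L + X ≡ S₁ → R + X ≡ S₂ → L ≤ R
≤-by-shift {L} {R} X S₁≤S₂ refl refl =
  subst₂ _≤_ (cancel L) (cancel R) (+-monoˡ-≤ (- X) S₁≤S₂)
  where
  cancel : ∀ A → A + X + - X ≡ A
  cancel A = solve (A ∷ X ∷ [])

≤-by-halving : ∀ {L R S₁ S₂} X → S₁ ≤ S₂ → + 2 * L + X ≡ S₁ → + 2 * R + X ≡ S₂ → L ≤ R
≤-by-halving {L} {R} X S₁≤S₂ e₁ e₂ = *-cancelˡ-≤-pos L R (+ 2) (≤-by-shift X S₁≤S₂ e₁ e₂)

Even Odd : ℤ → Set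
Even e = ∃ λ t → e ≡ + 2 * t
Odd e = ∃ λ t → e ≡ + 1 + + 2 * t

even-or-odd : ∀ e → Even e ⊎ Odd e
even-or-odd e with e %ℕ 2 | n%ℕd<d e 2 | a≡a%ℕn+[a/ℕn]*n e 2
... | 0 | _ | eq = inj₁ (e /ℕ 2 , trans eq (trans (+-identityˡ _) (*-comm (e /ℕ 2) (+ 2))))
... | 1 | _ | eq = inj₂ (e /ℕ 2 , trans eq (cong (_+_ (+ 1)) (*-comm (e /ℕ 2) (+ 2))))
... | suc (suc _) | s≤s (s≤s ()) | _

even-odd-disjoint : ∀ {e} → Even e → Odd e → ⊥
even-odd-disjoint (s , refl) (t , 2s≡1+2t) = 2≢1 (ℕ.∣1⇒≡1 (ℕ.divides ∣ s - t ∣ 1≡∣s-t∣*2))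
  where
  open ≡-Reasoning
  2≢1 : 2 ≢ 1
  2≢1 ()
  1≡[s-t]*2 : + 1 ≡ (s - t) * + 2
  1≡[s-t]*2 = begin
    + 1                        ≡⟨ solve (t ∷ []) ⟩
    (+ 1 + + 2 * t) - + 2 * t  ≡⟨ cong (_- + 2 * t) (sym 2s≡1+2t) ⟩
    + 2 * s - + 2 * t          ≡⟨ solve (s ∷ t ∷ []) ⟩
    (s - t) * + 2              ∎
  1≡∣s-t∣*2 : 1 ≡ ∣ s - t ∣ ℕ.* 2
  1≡∣s-t∣*2 = trans (cong ∣_∣ 1≡[s-t]*2) (abs-* (s - t) (+ 2))

Even-neg : ∀ {e} → Even e → Even (- e)
Even-neg (t , refl) = - t , solve (t ∷ [])

Even-+ : ∀ {e f} → Even e → Even f → Even (e + f)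
Even-+ (s , refl) (t , refl) = s + t , solve (s ∷ t ∷ [])

Odd-neg : ∀ {e} → Odd e → Odd (- e)
Odd-neg (t , refl) = - t - + 1 , solve (t ∷ [])

Odd-+-Even : ∀ {e f} → Odd e → Even f → Odd (e + f)
Odd-+-Even (s , refl) (t , refl) = s + t , solve (s ∷ t ∷ [])

Odd-+-Odd : ∀ {e f} → Odd e → Odd f → Even (e + f)
Odd-+-Odd (s , refl) (t , refl) = + 1 + s + t , solve (s ∷ t ∷ [])

odd≤even⇒odd<even : ∀ {e c} → Odd e → Even c → e ≤ c → + 1 + e ≤ c
odd≤even⇒odd<even (t , refl) (s , refl) 1+2t≤2s =
  subst (_≤ + 2 * s) 2[1+t]≡1+[1+2t] (*-monoˡ-≤-nonNeg (+ 2) 1+t≤s)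
  where
  2[1+t]≡1+[1+2t] : + 2 * (+ 1 + t) ≡ + 1 + (+ 1 + + 2 * t)
  2[1+t]≡1+[1+2t] = solve (t ∷ [])
  1+t≤s : + 1 + t ≤ s
  1+t≤s = i<j⇒suc[i]≤j (*-cancelˡ-<-nonNeg {t} {s} (+ 2) (suc[i]≤j⇒i<j 1+2t≤2s))

-- The octagon |x|, |y| ≤ s, |x| + |y| ≤ t, in linear form

infix 4 ∣_∣≤_
∣_∣≤_ : ℤ → ℤ → Set
∣ e ∣≤ c = (e ≤ c) × (- e ≤ c)

∣∣≤-neg : ∀ {c e} → ∣ e ∣≤ c → ∣ - e ∣≤ c
∣∣≤-neg {c} {e} (e≤c , -e≤c) = -e≤c , subst (_≤ c) (sym (neg-involutive e)) e≤c

∣∣≤-from-abs : ∀ {c e} → + ∣ e ∣ ≤ c → ∣ e ∣≤ c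
∣∣≤-from-abs {e = + n} n≤c = n≤c , ≤-trans (neg-≤-pos {n} {n}) n≤c
∣∣≤-from-abs {e = -[1+ n ]} 1+n≤c = ≤-trans -≤+ 1+n≤c , 1+n≤c

Octagon : ℤ → ℤ → ℤ[i] → Set
Octagon s t (x + y i) = (∣ x ∣≤ s × ∣ y ∣≤ s) × (∣ x + y ∣≤ t × ∣ x - y ∣≤ t)

OctagonAt : ℕ → ℤ[i] → Set
OctagonAt n = Octagon (+ w n - + 2) (+ w (suc n) - + 3)

Oct⇒OctagonAt : ∀ {n} z → Oct n z → OctagonAt n z
Oct⇒OctagonAt {n} (x + y i) (∣x∣≤ , ∣y∣≤ , ∣x∣+∣y∣≤) =
  (∣∣≤-from-abs ∣x∣≤ , ∣∣≤-from-abs ∣y∣≤) ,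
  (bounded-by-sum (∣i+j∣≤∣i∣+∣j∣ x y) , bounded-by-sum (∣i-j∣≤∣i∣+∣j∣ x y))
  where
  bounded-by-sum : ∀ {e} → ∣ e ∣ ℕ.≤ ∣ x ∣ ℕ.+ ∣ y ∣ → ∣ e ∣≤ (+ w (suc n) - + 3)
  bounded-by-sum {e} h = ∣∣≤-from-abs (≤-trans (subst (+ ∣ e ∣ ≤_) (pos-+ ∣ x ∣ ∣ y ∣) (+≤+ h)) ∣x∣+∣y∣≤)

i·_ : ℤ[i] → ℤ[i]
i· (x + y i) = (- y) + x i

i⁴·z≡z : ∀ z → i· i· i· i· z ≡ z
i⁴·z≡z (x + y i) = cong₂ _+_i (neg-involutive x) (neg-involutive y)

OddTrace : ℤ[i] → Set
OddTrace z = Odd (re z + im z)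

OddTrace-i· : ∀ {z} → OddTrace z → OddTrace (i· z)
OddTrace-i· {x + y i} odd = subst Odd trace-i·z (Odd-+-Even odd (- y , refl))
  where
  trace-i·z : x + y + + 2 * - y ≡ - y + x
  trace-i·z = solve (x ∷ y ∷ [])

Octagon-i· : ∀ {s t z} → Octagon s t z → Octagon s t (i· z)
Octagon-i· {s} {t} {x + y i} ((∣x∣≤ , ∣y∣≤) , (∣x+y∣≤ , ∣x-y∣≤)) =
  (∣∣≤-neg ∣y∣≤ , ∣x∣≤) ,
  (subst (λ e → ∣ e ∣≤ t) (+-comm x (- y)) ∣x-y∣≤ ,
   subst (λ e → ∣ e ∣≤ t) -[x+y]≡-y-x (∣∣≤-neg ∣x+y∣≤))
  where
  -[x+y]≡-y-x : - (x + y) ≡ - y - x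
  -[x+y]≡-y-x = solve (x ∷ y ∷ [])

i·ᵈ_ : Digit → Digit
i·ᵈ d0 = d0
i·ᵈ d1 = di
i·ᵈ di = d-1
i·ᵈ d-1 = d-i
i·ᵈ d-i = d1

digit-i· : ∀ d → digit (i·ᵈ d) ≡ i· digit d
digit-i· d0 = refl
digit-i· d1 = refl
digit-i· di = refl
digit-i· d-1 = refl
digit-i· d-i = refl

i·-digit-step : ∀ d z → i· (d ⊕ 1+i ⊗ z) ≡ i· d ⊕ 1+i ⊗ i· z
i·-digit-step (a + b i) (c + e i) = cong₂ _+_i (re-part b c e) (im-part a c e)
  where
  re-part : ∀ b c e → - (b + (+ 1 * e + + 1 * c)) ≡ - b + (+ 1 * - e - + 1 * c)
  re-part = solve-∀
  im-part : ∀ a c e → a + (+ 1 * c - + 1 * e) ≡ a + (+ 1 * c + + 1 * - e)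
  im-part = solve-∀

expand-i· : ∀ m v → expand m (i·ᵈ_ ∘ v) ≡ i· expand m v
expand-i· zero v = refl
expand-i· (suc m) v = begin
  digit (i·ᵈ v zero) ⊕ 1+i ⊗ expand m (i·ᵈ_ ∘ v ∘ suc)  ≡⟨ cong₂ (λ d z → d ⊕ 1+i ⊗ z) (digit-i· (v zero)) (expand-i· m (v ∘ suc)) ⟩
  i· digit (v zero) ⊕ 1+i ⊗ i· expand m (v ∘ suc)       ≡⟨ sym (i·-digit-step (digit (v zero)) (expand m (v ∘ suc))) ⟩
  i· (digit (v zero) ⊕ 1+i ⊗ expand m (v ∘ suc))        ∎
  where open ≡-Reasoning

B-i· : ∀ {n z} → B n z → B n (i· z)
B-i· {n} (v , refl) = i·ᵈ_ ∘ v , sym (expand-i· (suc n) v)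

B-cons : ∀ {n z} d → B n z → B (suc n) (digit d ⊕ 1+i ⊗ z)
B-cons d (v , refl) = d ◂ v , refl

-- Peeling off the lowest digit

record Peel (P : ℤ[i] → Set) (z : ℤ[i]) : Set where
  field
    head : Digit
    tail : ℤ[i]
    tail-odd : OddTrace tail
    tail-in : P tail
    split : z ≡ digit head ⊕ 1+i ⊗ tail

module _ {s t : ℤ} where

  Peel-i· : ∀ {z} → Peel (Octagon s t) z → Peel (Octagon s t) (i· z)
  Peel-i· p = record
    { head = i·ᵈ head
    ; tail = i· tail
    ; tail-odd = OddTrace-i· {tail} tail-odd
    ; tail-in = Octagon-i· tail-in
    ; split = trans (cong i·_ split)
                (trans (i·-digit-step (digit head) tail) (cong (_⊕ 1+i ⊗ i· tail) (sym (digit-i· head))))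
    }
    where open Peel p

  Peel-i·⁻¹ : ∀ {z} → Peel (Octagon s t) (i· z) → Peel (Octagon s t) z
  Peel-i·⁻¹ {z} p = subst (Peel (Octagon s t)) (i⁴·z≡z z) (Peel-i· (Peel-i· (Peel-i· p)))

module Peeling (W V : ℤ) (V-even : Even V) (4≤V : + 4 ≤ V) (V+2≤2W : V + + 2 ≤ + 2 * W) where

  Outer Inner : ℤ[i] → Set
  Outer = Octagon (V - + 2) (+ 2 * W - + 3)
  Inner = Octagon (W - + 2) (V - + 3)

  odd-tighten : ∀ {e} → Odd e → ∣ e ∣≤ V - + 2 → ∣ e ∣≤ V - + 3
  odd-tighten e-odd (e≤ , -e≤) = tighten e-odd e≤ , tighten (Odd-neg e-odd) -e≤
    where
    V-2-even : Even (V - + 2)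
    V-2-even = Even-+ V-even (-[1+ 0 ] , refl)
    tighten : ∀ {e} → Odd e → e ≤ V - + 2 → e ≤ V - + 3
    tighten {e} e-odd e≤ =
      ≤-by-shift (+ 1) (odd≤even⇒odd<even e-odd V-2-even e≤) (solve (e ∷ [])) (solve (V ∷ []))

  -- For x = 2p ≥ 0 and y = 2q + 1 take the digit 1: (x - 1 + yi) / (1 + i) = u + vi
  -- with u = p + q and v = q - p + 1.
  peel-normal : ∀ {x y} p q → x ≡ + 2 * p → y ≡ + 1 + + 2 * q → + 0 ≤ p →
                Outer (x + y i) → Peel Inner (x + y i)
  peel-normal p q refl refl 0≤p ((∣x∣≤ , ∣y∣≤) , (∣x+y∣≤ , ∣x-y∣≤)) = record
    { head = d1
    ; tail = (p + q) + (q - p + + 1) i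
    ; tail-odd = q , u+v≡y
    ; tail-in = (∣u∣≤ , ∣v∣≤) , (∣u+v∣≤ , ∣u-v∣≤)
    ; split = cong₂ _+_i (x≡1+u-v p q) (y≡0+v+u p q)
    }
    where
    x≡1+u-v : ∀ p q → + 2 * p ≡ + 1 + (+ 1 * (p + q) - + 1 * (q - p + + 1))
    x≡1+u-v = solve-∀
    y≡0+v+u : ∀ p q → + 1 + + 2 * q ≡ + 0 + (+ 1 * (q - p + + 1) + + 1 * (p + q))
    y≡0+v+u = solve-∀
    u+v≡y : p + q + (q - p + + 1) ≡ + 1 + + 2 * q
    u+v≡y = solve (p ∷ q ∷ [])
    ∣y∣≤V-3 : ∣ + 1 + + 2 * q ∣≤ V - + 3
    ∣y∣≤V-3 = odd-tighten (q , refl) ∣y∣≤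
    ∣u∣≤ : ∣ p + q ∣≤ W - + 2
    ∣u∣≤ = ≤-by-halving (+ 1) (proj₁ ∣x+y∣≤) (solve (p ∷ q ∷ [])) (solve (W ∷ [])) ,
           ≤-by-halving (+ 2 * p + V + + 1)
             (+-mono-≤ (+-mono-≤ (+-mono-≤ (proj₂ ∣y∣≤V-3) 0≤p) 0≤p) V+2≤2W)
             (solve (p ∷ q ∷ V ∷ [])) (solve (p ∷ V ∷ W ∷ []))
    ∣v∣≤ : ∣ q - p + + 1 ∣≤ W - + 2
    ∣v∣≤ = ≤-by-halving (+ 2 * p + V + + 1)
             (+-mono-≤ (+-mono-≤ (+-mono-≤ (proj₁ ∣y∣≤V-3) 0≤p) 0≤p) V+2≤2W)
             (solve (p ∷ q ∷ V ∷ [])) (solve (p ∷ V ∷ W ∷ [])) ,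
           ≤-by-halving (+ 1) (proj₁ ∣x-y∣≤) (solve (p ∷ q ∷ [])) (solve (W ∷ []))
    ∣u+v∣≤ : ∣ p + q + (q - p + + 1) ∣≤ V - + 3
    ∣u+v∣≤ = subst (λ e → ∣ e ∣≤ V - + 3) (sym u+v≡y) ∣y∣≤V-3
    ∣u-v∣≤ : ∣ p + q - (q - p + + 1) ∣≤ V - + 3
    ∣u-v∣≤ = ≤-by-shift (+ 1) (proj₁ ∣x∣≤) (solve (p ∷ q ∷ [])) (solve (V ∷ [])) ,
             ≤-by-shift (+ 3 + + 2 * p) (+-mono-≤ (+-mono-≤ 4≤V 0≤p) 0≤p)
               (solve (p ∷ q ∷ [])) (solve (p ∷ V ∷ []))

  peel-even-re : ∀ {x y} → Even x → Odd (x + y) → Outer (x + y i) → Peel Inner (x + y i)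
  peel-even-re {x} {y} (p , x≡2p) trace-odd oct with odd-y | ≤-total (+ 0) p
    where
    y≡[x+y]-x : y ≡ x + y + - x
    y≡[x+y]-x = solve (x ∷ y ∷ [])
    odd-y : Odd y
    odd-y = subst Odd (sym y≡[x+y]-x) (Odd-+-Even trace-odd (Even-neg (p , x≡2p)))
  ... | q , y≡1+2q | inj₁ 0≤p = peel-normal p q x≡2p y≡1+2q 0≤p oct
  ... | q , y≡1+2q | inj₂ p≤0 =
    Peel-i·⁻¹ (Peel-i·⁻¹ (peel-normal (- p) (- q - + 1) (-x≡ x≡2p) (-y≡ y≡1+2q) (neg-mono-≤ p≤0)
                                        (Octagon-i· (Octagon-i· oct))))
    where
    -x≡ : x ≡ + 2 * p → - x ≡ + 2 * - p
    -x≡ refl = solve (p ∷ [])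
    -y≡ : y ≡ + 1 + + 2 * q → - y ≡ + 1 + + 2 * (- q - + 1)
    -y≡ refl = solve (q ∷ [])

  peel : ∀ {z} → OddTrace z → Outer z → Peel Inner z
  peel {x + y i} trace-odd oct with even-or-odd x
  ... | inj₁ x-even = peel-even-re x-even trace-odd oct
  ... | inj₂ x-odd =
    Peel-i·⁻¹ (peel-even-re -y-even (OddTrace-i· {x + y i} trace-odd) (Octagon-i· oct))
    where
    -y≡x-[x+y] : x + - (x + y) ≡ - y
    -y≡x-[x+y] = solve (x ∷ y ∷ [])
    -y-even : Even (- y)
    -y-even = subst Even -y≡x-[x+y] (Odd-+-Odd x-odd (Odd-neg trace-odd))

3≤w : ∀ n → 3 ℕ.≤ w n
3≤w zero = ℕ.≤-refl
3≤w (suc zero) = ℕ.n≤1+n 3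
3≤w (suc (suc n)) = ℕ.≤-trans (ℕ.m≤m+n 3 3) (ℕ.*-monoʳ-≤ 2 (3≤w n))

4≤w-suc : ∀ n → 4 ℕ.≤ w (suc n)
4≤w-suc zero = ℕ.≤-refl
4≤w-suc (suc n) = ℕ.≤-trans (ℕ.m≤m+n 4 2) (ℕ.*-monoʳ-≤ 2 (3≤w n))

w-suc+2≤2w : ∀ n → w (suc n) ℕ.+ 2 ℕ.≤ 2 ℕ.* w n
w-suc+2≤2w zero = ℕ.≤-refl
w-suc+2≤2w (suc zero) = ℕ.≤-refl
w-suc+2≤2w (suc (suc n)) = begin
  2 ℕ.* w (suc n) ℕ.+ 2        ≤⟨ ℕ.+-monoʳ-≤ (2 ℕ.* w (suc n)) (ℕ.m≤m+n 2 2) ⟩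
  2 ℕ.* w (suc n) ℕ.+ 2 ℕ.* 2  ≡⟨ ℕ.*-distribˡ-+ 2 (w (suc n)) 2 ⟨
  2 ℕ.* (w (suc n) ℕ.+ 2)      ≤⟨ ℕ.*-monoʳ-≤ 2 (w-suc+2≤2w n) ⟩
  2 ℕ.* (2 ℕ.* w n)            ∎
  where open ≤-Reasoning

w-suc-even : ∀ n → Even (+ w (suc n))
w-suc-even zero = + 2 , refl
w-suc-even (suc n) = + w n , pos-* 2 (w n)

peel-at : ∀ n {z} → OddTrace z → OctagonAt (suc n) z → Peel (OctagonAt n) z
peel-at n {z} trace-odd oct =
  Peeling.peel (+ w n) (+ w (suc n)) (w-suc-even n) (+≤+ (4≤w-suc n)) V+2≤2W trace-odd
    (subst (λ c → Octagon (+ w (suc n) - + 2) (c - + 3) z) (pos-* 2 (w n)) oct)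
  where
  V+2≤2W : + w (suc n) + + 2 ≤ + 2 * + w n
  V+2≤2W = subst (+ w (suc n) + + 2 ≤_) (pos-* 2 (w n)) (+≤+ (w-suc+2≤2w n))

∣∣≤1 : ∀ {e} → ∣ e ∣≤ + 1 → e ≡ + 0 ⊎ e ≡ + 1 ⊎ e ≡ -[1+ 0 ]
∣∣≤1 {+ 0} _ = inj₁ refl
∣∣≤1 {+ 1} _ = inj₂ (inj₁ refl)
∣∣≤1 {+ suc (suc n)} (+≤+ (s≤s ()) , _)
∣∣≤1 { -[1+ 0 ]} _ = inj₂ (inj₂ refl)
∣∣≤1 { -[1+ suc n ]} (_ , +≤+ (s≤s ()))

2≰1 : ¬ (+ 2 ≤ + 1)
2≰1 (+≤+ (s≤s ()))

odd-octagon⊆B₀ : ∀ {z} → OddTrace z → OctagonAt 0 z → B 0 z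
odd-octagon⊆B₀ {x + y i} trace-odd ((∣x∣≤ , ∣y∣≤) , (∣x+y∣≤ , ∣x-y∣≤)) with ∣∣≤1 ∣x∣≤ | ∣∣≤1 ∣y∣≤
... | inj₁ refl        | inj₁ refl        = ⊥-elim (even-odd-disjoint (+ 0 , refl) trace-odd)
... | inj₁ refl        | inj₂ (inj₁ refl) = (λ _ → di) , refl
... | inj₁ refl        | inj₂ (inj₂ refl) = (λ _ → d-i) , refl
... | inj₂ (inj₁ refl) | inj₁ refl        = (λ _ → d1) , refl
... | inj₂ (inj₂ refl) | inj₁ refl        = (λ _ → d-1) , refl
... | inj₂ (inj₁ refl) | inj₂ (inj₁ refl) = ⊥-elim (2≰1 (proj₁ ∣x+y∣≤))
... | inj₂ (inj₁ refl) | inj₂ (inj₂ refl) = ⊥-elim (2≰1 (proj₁ ∣x-y∣≤))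
... | inj₂ (inj₂ refl) | inj₂ (inj₁ refl) = ⊥-elim (2≰1 (proj₂ ∣x-y∣≤))
... | inj₂ (inj₂ refl) | inj₂ (inj₂ refl) = ⊥-elim (2≰1 (proj₂ ∣x+y∣≤))

odd-octagon⊆B : ∀ n {z} → OddTrace z → OctagonAt n z → B n z
odd-octagon⊆B zero = odd-octagon⊆B₀
odd-octagon⊆B (suc n) trace-odd oct =
  subst (B (suc n)) (sym split) (B-cons head (odd-octagon⊆B n tail-odd tail-in))
  where open Peel (peel-at n trace-odd oct)

OddTrace-of-∤ : ∀ {z} → ¬ (1+i ∣ᵍ z) → OddTrace z
OddTrace-of-∤ {a + b i} 1+i∤z with even-or-odd (a + b)
... | inj₂ trace-odd = trace-odd
... | inj₁ (t , a+b≡2t) = ⊥-elim (1+i∤z (t + (t - a) i , cong₂ _+_i a≡ b≡))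
  where
  open ≡-Reasoning
  a≡ : a ≡ + 1 * t - + 1 * (t - a)
  a≡ = solve (a ∷ t ∷ [])
  b≡ : b ≡ + 1 * (t - a) + + 1 * t
  b≡ = begin
    b                          ≡⟨ solve (a ∷ b ∷ []) ⟩
    a + b - a                  ≡⟨ cong (_- a) a+b≡2t ⟩
    + 2 * t - a                ≡⟨ solve (a ∷ t ∷ []) ⟩
    + 1 * (t - a) + + 1 * t    ∎

Even-of-∣ : ∀ {e} → + 2 ∣ e → Even e
Even-of-∣ (divides q refl) = q , *-comm q (+ 2)

Even-of-2ᵏ∣gcd : ∀ x y k → k ≥ 1 → (+ 2) ^ k ∣ᵤ gcd x y → Even x × Even y
Even-of-2ᵏ∣gcd x y (suc k) _ 2ᵏ∣gcd =
  Even-of-∣ (∣-trans 2∣gcd (∣ᵤ⇒∣ (gcd[i,j]∣i x y))) , Even-of-∣ (∣-trans 2∣gcd (∣ᵤ⇒∣ (gcd[i,j]∣j x y)))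
  where
  2∣gcd : + 2 ∣ gcd x y
  2∣gcd = ∣-trans (∣m⇒∣m*n ((+ 2) ^ k) ∣-refl) (∣ᵤ⇒∣ 2ᵏ∣gcd)

lemma3p2 : (n : ℕ) (a b x y : ℤ) →
    ¬ (1+i ∣ᵍ (a + b i)) →
    (∃ λ k → (k ≥ 1) × pow2exactly k (gcd x y)) →
    (Oct n ((a - x) + (b - y) i) ⊎ Oct n ((a - y) + (b + x) i) ⊎ Oct n ((- (b + x)) + (a - y) i)) →
    U n (a + b i) (x + y i)
lemma3p2 n a b x y 1+i∤α (k , k≥1 , 2ᵏ∣gcd , _) = λ where
    (inj₁ γ₁∈Oct) →
      1ᵍ , i· i· γ₁ , B-i· (B-i· (odd-octagon⊆B n γ₁-odd (Oct⇒OctagonAt {n} γ₁ γ₁∈Oct))) ,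
      cong₂ _+_i (x≡-re[γ₁]+re[α] a b x) (y≡-im[γ₁]+im[α] a b y)
    (inj₂ γ₂∈Oct⊎γ₃∈Oct) →
      (+ 0) + (+ 1) i , i· i· γ₃ , B-i· (B-i· (odd-octagon⊆B n γ₃-odd (γ₃∈OctagonAt γ₂∈Oct⊎γ₃∈Oct))) ,
      cong₂ _+_i (x≡-re[γ₃]+re[iα] a b x) (y≡-im[γ₃]+im[iα] a b y)
  where
  γ₁ γ₂ γ₃ : ℤ[i]
  γ₁ = (a - x) + (b - y) i
  γ₂ = (a - y) + (b + x) i
  γ₃ = i· γ₂

  α-odd : Odd (a + b)
  α-odd = OddTrace-of-∤ 1+i∤α

  x-even : Even x
  x-even = proj₁ (Even-of-2ᵏ∣gcd x y k k≥1 2ᵏ∣gcd)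

  y-even : Even y
  y-even = proj₂ (Even-of-2ᵏ∣gcd x y k k≥1 2ᵏ∣gcd)

  trace-γ₁ : ∀ a b x y → a + b + (- x + - y) ≡ a - x + (b - y)
  trace-γ₁ = solve-∀
  trace-γ₂ : ∀ a b x y → a + b + (x + - y) ≡ a - y + (b + x)
  trace-γ₂ = solve-∀

  γ₁-odd : OddTrace γ₁
  γ₁-odd = subst Odd (trace-γ₁ a b x y) (Odd-+-Even α-odd (Even-+ (Even-neg x-even) (Even-neg y-even)))

  γ₃-odd : OddTrace γ₃
  γ₃-odd = OddTrace-i· {γ₂} (subst Odd (trace-γ₂ a b x y) (Odd-+-Even α-odd (Even-+ x-even (Even-neg y-even))))

  γ₃∈OctagonAt : Oct n γ₂ ⊎ Oct n γ₃ → OctagonAt n γ₃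
  γ₃∈OctagonAt (inj₁ γ₂∈Oct) = Octagon-i· (Oct⇒OctagonAt {n} γ₂ γ₂∈Oct)
  γ₃∈OctagonAt (inj₂ γ₃∈Oct) = Oct⇒OctagonAt {n} γ₃ γ₃∈Oct

  x≡-re[γ₁]+re[α] : ∀ a b x → x ≡ - (a - x) + (+ 1 * a - + 0 * b)
  x≡-re[γ₁]+re[α] = solve-∀
  y≡-im[γ₁]+im[α] : ∀ a b y → y ≡ - (b - y) + (+ 1 * b + + 0 * a)
  y≡-im[γ₁]+im[α] = solve-∀
  x≡-re[γ₃]+re[iα] : ∀ a b x → x ≡ - - (b + x) + (+ 0 * a - + 1 * b)
  x≡-re[γ₃]+re[iα] = solve-∀
  y≡-im[γ₃]+im[iα] : ∀ a b y → y ≡ - (a - y) + (+ 0 * b + + 1 * a)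
  y≡-im[γ₃]+im[iα] = solve-∀
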